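{- Let $G$ be a connected graph with chromatic number $\chi(G)=k$ and independence number $\alpha(G)=2$. Suppose $G$ has a cut-set $S$ with $|S|\leq 2$ that is a stable set. Then: (i) $G\setminus S$ has exactly two connected components, say $G_1$ and $G_2$; (ii) $G_1$ and $G_2$ are complete graphs; (iii) $\max\{\chi(G_1),\chi(G_2)\}\geq k-1$; (iv) for every $u\in S$, either $V(G_1)\subseteq N_G(u)$ or $V(G_2)\subseteq N_G(u)$.
   Context: All graphs are finite and simple. A cut-set of a connected graph is a subset of the vertex set whose removal disconnects the graph. A stable set is a set of pairwise nonadjacent vertices; $\alpha(G)$ is the maximum size of a stable set. $N_G(u)$ is the set of neighbors of $u$ in $G$. -}

module Defs where

open import Data.Nat using (ℕ; _≤_; _⊔_; _∸_)
open import Data.Fin using (Fin)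
open import Data.Fin.Subset using (Subset; _∈_; _∉_; ∣_∣)
open import Data.Bool using (Bool; T)
open import Data.Product using (Σ; ∃; _×_; _,_)
open import Data.Empty using (⊥)
open import Relation.Nullary using (¬_)
open import Relation.Binary.PropositionalEquality using (_≡_; _≢_)

record Graph (n : ℕ) : Set where
  field
    adj   : Fin n → Fin n → Bool
    sym   : ∀ u v → adj u v ≡ adj v u
    irrefl : ∀ u → adj u u ≡ Data.Bool.false

open Graph public

module _ {n : ℕ} (G : Graph n) where

  Adj : Fin n → Fin n → Set
  Adj u v = T (adj G u v)

  -- Reach P u v : there is a path from u to v all of whose vertices satisfy P
  -- (i.e. u and v are connected in the induced subgraph G[P]).
  data Reach (P : Fin n → Set) (u : Fin n) : Fin n → Set where
    here : P u → Reach P u u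
    step : ∀ {v w} → Reach P u v → Adj v w → P w → Reach P u w

  Everything : Fin n → Set
  Everything _ = Data.Unit.⊤
    where import Data.Unit

  Connected : Set
  Connected = Fin n × (∀ u v → Reach Everything u v)

  Outside : Subset n → Fin n → Set
  Outside S v = v ∉ S

  CutSet : Subset n → Set
  CutSet S = Σ (Fin n) λ u → Σ (Fin n) λ v →
    (u ∉ S) × (v ∉ S) × ¬ Reach (Outside S) u v

  Stable : Subset n → Set
  Stable S = ∀ u v → u ∈ S → v ∈ S → ¬ Adj u v

  IndependenceNumber : ℕ → Set
  IndependenceNumber a =
    (Σ (Subset n) λ S → Stable S × ∣ S ∣ ≡ a) ×
    (∀ S → Stable S → ∣ S ∣ ≤ a)

  ProperColouring : (Fin n → Set) → (j : ℕ) → (Fin n → Fin j) → Set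
  ProperColouring P j c = ∀ u v → P u → P v → Adj u v → c u ≢ c v

  Colourable : (Fin n → Set) → ℕ → Set
  Colourable P j = Σ (Fin n → Fin j) λ c → ProperColouring P j c

  ChromaticNumberOn : (Fin n → Set) → ℕ → Set
  ChromaticNumberOn P k = Colourable P k × (∀ j → Colourable P j → k ≤ j)

  ChromaticNumber : ℕ → Set
  ChromaticNumber k = ChromaticNumberOn Everything k

  Complete : (Fin n → Set) → Set
  Complete P = ∀ u v → P u → P v → u ≢ v → Adj u v

  ComponentOf : Subset n → Fin n → Fin n → Set
  ComponentOf S u v = Reach (Outside S) u v

module Submission where

-- The only consequence of α(G) = 2 that the argument needs is that G has
-- no stable set of three distinct vertices.  Fix two vertices u₁, u₂ of
-- G ∖ S that lie in different components G₁ ∋ u₁ and G₂ ∋ u₂.  Each of the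
-- claims is an instance of "these three vertices would be a stable triple":
--   * every vertex of G₁ is u₁ or a neighbour of u₁ (else it, u₁, u₂ are
--     stable), which makes G₁ decidable and disjoint from G₂;
--   * every vertex of G ∖ S is in G₁ or G₂ (else it, u₁, u₂ are stable);
--   * G₁ is complete (two non-adjacent vertices of G₁ together with u₂);
--   * u ∈ S cannot miss a vertex of both G₁ and G₂ (those two and u).
-- For (iii), a complete graph needs exactly as many colours as vertices;
-- colouring G₁ and G₂ with the same max{χ(G₁), χ(G₂)} colours and the stable
-- set S with one extra colour properly colours G, so k ≤ max + 1.

open import Defs hiding (sym)
open import Data.Nat using (ℕ; suc; _≤_; _⊔_; _∸_; s≤s)
open import Data.Nat.Properties using (m≤m⊔n; m≤n⊔m; ∸-monoˡ-≤)
open import Data.Fin using (Fin; zero; suc; _≟_; fromℕ; inject₁; inject≤)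
open import Data.Fin.Properties using (any?; fromℕ≢inject₁; inject₁-injective; inject≤-injective; injective⇒≤)
open import Data.Fin.Subset using (Subset; _∈_; _∉_; ∣_∣; _∪_; ⁅_⁆; inside; outside)
open import Data.Fin.Subset.Properties using (_∈?_; x∈p∪q⁻; x∈⁅y⁆⇒x≡y; x≢y⇒x∉⁅y⁆; ∪-identityʳ; ∣⁅x⁆∣≡1)
open import Data.Vec using (_∷_; here; there)
open import Data.List using (List; filter; length; lookup; allFin)
import Data.List.Relation.Unary.All as All
open import Data.List.Relation.Unary.All.Properties using (all-filter)
open import Data.List.Relation.Unary.AllPairs using (_∷_)
open import Data.List.Relation.Unary.Unique.Propositional using (Unique)
open import Data.List.Relation.Unary.Unique.Propositional.Properties using (allFin⁺; filter⁺)
open import Data.List.Membership.Propositional.Properties using (∈-filter⁺; ∈-allFin; ∈-lookup)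
open import Data.List.Relation.Unary.Any using (index)
open import Data.List.Relation.Unary.Any.Properties using (lookup-index)
open import Data.Bool using (T; T?)
open import Data.Empty using (⊥; ⊥-elim)
open import Data.Product using (Σ; _×_; _,_; proj₁)
open import Data.Sum using (_⊎_; inj₁; inj₂; [_,_])
open import Function using (_∘_)
open import Relation.Nullary using (¬_; Dec; yes; no)
open import Relation.Nullary.Decidable using (_×-dec_; ¬?)
open import Relation.Unary using (Decidable)
open import Relation.Binary.PropositionalEquality using (_≡_; _≢_; refl; sym; trans; cong; subst)

∣p∪⁅x⁆∣≡1+∣p∣ : ∀ {n} (x : Fin n) (p : Subset n) → x ∉ p → ∣ p ∪ ⁅ x ⁆ ∣ ≡ suc ∣ p ∣
∣p∪⁅x⁆∣≡1+∣p∣ zero    (inside  ∷ p) x∉p = ⊥-elim (x∉p here)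
∣p∪⁅x⁆∣≡1+∣p∣ zero    (outside ∷ p) x∉p = cong (suc ∘ ∣_∣) (∪-identityʳ p)
∣p∪⁅x⁆∣≡1+∣p∣ (suc x) (inside  ∷ p) x∉p = cong suc (∣p∪⁅x⁆∣≡1+∣p∣ x p (x∉p ∘ there))
∣p∪⁅x⁆∣≡1+∣p∣ (suc x) (outside ∷ p) x∉p = ∣p∪⁅x⁆∣≡1+∣p∣ x p (x∉p ∘ there)

∈⁅⁆-elim : ∀ {n} {P : Fin n → Set} a → P a → ∀ v → v ∈ ⁅ a ⁆ → P v
∈⁅⁆-elim {P = P} a pa v v∈ = subst P (sym (x∈⁅y⁆⇒x≡y a v∈)) pa

∈⁅⁆∪⁅⁆-elim : ∀ {n} {P : Fin n → Set} a b → P a → P b → ∀ v → v ∈ ⁅ a ⁆ ∪ ⁅ b ⁆ → P v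
∈⁅⁆∪⁅⁆-elim a b pa pb v v∈ with x∈p∪q⁻ ⁅ a ⁆ ⁅ b ⁆ v∈
... | inj₁ v∈a = ∈⁅⁆-elim a pa v v∈a
... | inj₂ v∈b = ∈⁅⁆-elim b pb v v∈b

lookup-injective : ∀ {A : Set} {xs : List A} → Unique xs →
                   ∀ i j → lookup xs i ≡ lookup xs j → i ≡ j
lookup-injective (x∉xs ∷ _)    zero    zero    _  = refl
lookup-injective (x∉xs ∷ _)    zero    (suc j) eq = ⊥-elim (All.lookup x∉xs (∈-lookup j) eq)
lookup-injective (x∉xs ∷ _)    (suc i) zero    eq = ⊥-elim (All.lookup x∉xs (∈-lookup i) (sym eq))
lookup-injective (_    ∷ uxs) (suc i) (suc j) eq = cong suc (lookup-injective uxs i j eq)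

embed : ∀ {k K} → k ≤ K → Fin k → Fin (suc K)
embed k≤K i = inject₁ (inject≤ i k≤K)

embed-injective : ∀ {k K} (k≤K : k ≤ K) {i j} → embed k≤K i ≡ embed k≤K j → i ≡ j
embed-injective k≤K {i} {j} = inject≤-injective k≤K k≤K i j ∘ inject₁-injective

module _ {n : ℕ} (G : Graph n) where

  adj? : ∀ u v → Dec (Adj G u v)
  adj? u v = T? (adj G u v)

  Adj-sym : ∀ {u v} → Adj G u v → Adj G v u
  Adj-sym {u} {v} = subst T (Graph.sym G u v)

  Adj-irrefl : ∀ u → ¬ Adj G u u
  Adj-irrefl u = subst T (irrefl G u)

  reach-end : ∀ {P u v} → Reach G P u v → P v
  reach-end (here pu)     = pu
  reach-end (step _ _ pv) = pv

  reach-cons : ∀ {P u w v} → P u → Adj G u w → Reach G P w v → Reach G P u v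
  reach-cons pu uw (here pw)       = step (here pu) uw pw
  reach-cons pu uw (step r xv pv)  = step (reach-cons pu uw r) xv pv

  reach-sym : ∀ {P u v} → Reach G P u v → Reach G P v u
  reach-sym (here pu)      = here pu
  reach-sym (step r wv pv) = reach-cons pv (Adj-sym wv) (reach-sym r)

  stable-⁅⁆ : ∀ a → Stable G ⁅ a ⁆
  stable-⁅⁆ a u v u∈ v∈ with refl ← x∈⁅y⁆⇒x≡y a u∈ | refl ← x∈⁅y⁆⇒x≡y a v∈ = Adj-irrefl a

  stable-∪⁅⁆ : ∀ {X} x → Stable G X → (∀ v → v ∈ X → ¬ Adj G x v) → Stable G (X ∪ ⁅ x ⁆)
  stable-∪⁅⁆ {X} x stX far u v u∈ v∈ with x∈p∪q⁻ X ⁅ x ⁆ u∈ | x∈p∪q⁻ X ⁅ x ⁆ v∈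
  ... | inj₁ u∈X | inj₁ v∈X = stX u v u∈X v∈X
  ... | inj₁ u∈X | inj₂ v∈x with refl ← x∈⁅y⁆⇒x≡y x v∈x = far u u∈X ∘ Adj-sym
  ... | inj₂ u∈x | inj₁ v∈X with refl ← x∈⁅y⁆⇒x≡y x u∈x = far v v∈X
  ... | inj₂ u∈x | inj₂ v∈x = stable-⁅⁆ x u v u∈x v∈x

  NoStableTriple : Set
  NoStableTriple = ∀ a b c → a ≢ b → a ≢ c → b ≢ c →
                   ¬ Adj G a b → ¬ Adj G a c → ¬ Adj G b c → ⊥

  α≤2⇒no-stable-triple : (∀ X → Stable G X → ∣ X ∣ ≤ 2) → NoStableTriple
  α≤2⇒no-stable-triple α≤2 a b c a≢b a≢c b≢c ab ac bc =
    3≰2 (subst (_≤ 2) size (α≤2 _ stable))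
    where
    c∉ab : c ∉ ⁅ a ⁆ ∪ ⁅ b ⁆
    c∉ab c∈ab = ∈⁅⁆∪⁅⁆-elim {P = _≢ c} a b a≢c b≢c c c∈ab refl

    size : ∣ (⁅ a ⁆ ∪ ⁅ b ⁆) ∪ ⁅ c ⁆ ∣ ≡ 3
    size = trans (∣p∪⁅x⁆∣≡1+∣p∣ c _ c∉ab)
                 (cong suc (trans (∣p∪⁅x⁆∣≡1+∣p∣ b _ (x≢y⇒x∉⁅y⁆ (a≢b ∘ sym)))
                                  (cong suc (∣⁅x⁆∣≡1 a))))

    stable : Stable G ((⁅ a ⁆ ∪ ⁅ b ⁆) ∪ ⁅ c ⁆)
    stable = stable-∪⁅⁆ c (stable-∪⁅⁆ b (stable-⁅⁆ a) (∈⁅⁆-elim a (ab ∘ Adj-sym)))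
                          (∈⁅⁆∪⁅⁆-elim a b (ac ∘ Adj-sym) (bc ∘ Adj-sym))

    3≰2 : ¬ (3 ≤ 2)
    3≰2 (s≤s (s≤s ()))

  members : {P : Fin n → Set} → Decidable P → List (Fin n)
  members P? = filter P? (allFin n)

  -- G[P] can be coloured injectively with |P| colours: give each vertex its
  -- position in the list of members (vertices outside P get any colour).
  module PositionColouring {P : Fin n → Set} (P? : Decidable P) {p} (pp : P p) where

    position : ∀ {v} → P v → Fin (length (members P?))
    position {v} pv = index (∈-filter⁺ P? (∈-allFin v) pv)

    colour : Fin n → Fin (length (members P?))
    colour v with P? v
    ... | yes pv = position pv
    ... | no  _  = position pp

    colour-correct : ∀ v → P v → lookup (members P?) (colour v) ≡ v
    colour-correct v pv with P? v
    ... | yes pv′ = sym (lookup-index (∈-filter⁺ P? (∈-allFin v) pv′))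
    ... | no ¬pv  = ⊥-elim (¬pv pv)

    proper : ProperColouring G P _ colour
    proper u v pu pv uv same = Adj-irrefl v (subst (λ w → Adj G w v) u≡v uv)
      where
      u≡v : u ≡ v
      u≡v = trans (sym (colour-correct u pu))
                  (trans (cong (lookup (members P?)) same) (colour-correct v pv))

  -- In a complete G[P] any proper colouring is injective on P, so it uses
  -- at least |P| colours.
  complete-colours-≥ : ∀ {P} (P? : Decidable P) → Complete G P →
                       ∀ j → Colourable G P j → length (members P?) ≤ j
  complete-colours-≥ {P} P? complete j (c , proper) = injective⇒≤ {f = c ∘ lookup (members P?)} injective
    where
    inP : ∀ i → P (lookup (members P?) i)
    inP i = All.lookup (all-filter P? (allFin n)) (∈-lookup i)

    injective : ∀ {i i′} → c (lookup (members P?) i) ≡ c (lookup (members P?) i′) → i ≡ i′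
    injective {i} {i′} same with lookup (members P?) i ≟ lookup (members P?) i′
    ... | yes eq = lookup-injective (filter⁺ P? (allFin⁺ n)) i i′ eq
    ... | no neq = ⊥-elim (proper _ _ (inP i) (inP i′) (complete _ _ (inP i) (inP i′) neq) same)

  complete-chromatic : ∀ {P} (P? : Decidable P) → Complete G P → ∀ {p} → P p →
                       ChromaticNumberOn G P (length (members P?))
  complete-chromatic P? complete pp =
    (colour , proper) , complete-colours-≥ P? complete
    where open PositionColouring P? pp

  glue-colourings : ∀ {S C₁ C₂ k₁ k₂} → Stable G S →
    (∀ v → v ∉ S → C₁ v ⊎ C₂ v) → (∀ u v → C₁ u → C₂ v → ¬ Adj G u v) →
    Colourable G C₁ k₁ → Colourable G C₂ k₂ →
    Colourable G (Everything G) (suc (k₁ ⊔ k₂))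
  glue-colourings {S} {C₁} {C₂} {k₁} {k₂} stS cover apart (c₁ , proper₁) (c₂ , proper₂) =
    colour , proper
    where
    K = k₁ ⊔ k₂

    side : ∀ v → C₁ v ⊎ C₂ v → Fin (suc K)
    side v (inj₁ _) = embed (m≤m⊔n k₁ k₂) (c₁ v)
    side v (inj₂ _) = embed (m≤n⊔m k₁ k₂) (c₂ v)

    part : ∀ v → Dec (v ∈ S) → Fin (suc K)
    part v (yes _)   = fromℕ K
    part v (no v∉S)  = side v (cover v v∉S)

    colour : Fin n → Fin (suc K)
    colour v = part v (v ∈? S)

    proper : ProperColouring G (Everything G) (suc K) colour
    proper u v _ _ uv with u ∈? S | v ∈? S
    ... | yes u∈S | yes v∈S = λ _ → stS u v u∈S v∈S uv
    ... | yes _   | no v∉S with cover v v∉S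
    ...   | inj₁ _ = fromℕ≢inject₁
    ...   | inj₂ _ = fromℕ≢inject₁
    proper u v _ _ uv | no u∉S | yes _ with cover u u∉S
    ...   | inj₁ _ = fromℕ≢inject₁ ∘ sym
    ...   | inj₂ _ = fromℕ≢inject₁ ∘ sym
    proper u v _ _ uv | no u∉S | no v∉S with cover u u∉S | cover v v∉S
    ...   | inj₁ u₁ | inj₁ v₁ = proper₁ u v u₁ v₁ uv ∘ embed-injective (m≤m⊔n k₁ k₂)
    ...   | inj₁ u₁ | inj₂ v₂ = ⊥-elim (apart u v u₁ v₂ uv)
    ...   | inj₂ u₂ | inj₁ v₁ = ⊥-elim (apart v u v₁ u₂ (Adj-sym uv))
    ...   | inj₂ u₂ | inj₂ v₂ = proper₂ u v u₂ v₂ uv ∘ embed-injective (m≤n⊔m k₁ k₂)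

  module Separated (noTriple : NoStableTriple) (S : Subset n)
                   {x y : Fin n} (x∉S : x ∉ S) (y∉S : y ∉ S)
                   (x↛y : ¬ Reach G (Outside G S) x y) where

    Gₓ : Fin n → Set
    Gₓ = Reach G (Outside G S) x

    ≢y : ∀ {v} → Gₓ v → v ≢ y
    ≢y xv refl = x↛y xv

    ¬Adj-y : ∀ {v} → Gₓ v → ¬ Adj G v y
    ¬Adj-y xv vy = x↛y (step xv vy y∉S)

    dominated : ∀ {v} → Gₓ v → v ≡ x ⊎ Adj G x v
    dominated {v} xv with v ≟ x | adj? x v
    ... | yes v≡x | _      = inj₁ v≡x
    ... | no _    | yes xv′ = inj₂ xv′
    ... | no v≢x  | no ¬xv = ⊥-elim (noTriple x y v (≢y (here x∉S)) (v≢x ∘ sym)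
                             (≢y xv ∘ sym) (¬Adj-y (here x∉S)) ¬xv (¬Adj-y xv ∘ Adj-sym))

    component? : Decidable Gₓ
    component? v with v ∈? S | v ≟ x | adj? x v
    ... | yes v∈S | _       | _      = no λ xv → reach-end xv v∈S
    ... | no _    | yes refl | _     = yes (here x∉S)
    ... | no v∉S  | no _    | yes xv = yes (step (here x∉S) xv v∉S)
    ... | no _    | no v≢x  | no ¬xv = no λ xv → [ v≢x , ¬xv ] (dominated xv)

    -- Two non-adjacent vertices of the component, with y, would be stable.
    complete : Complete G Gₓ
    complete a b xa xb a≢b with adj? a b
    ... | yes ab = ab
    ... | no ¬ab = ⊥-elim (noTriple a b y a≢b (≢y xa) (≢y xb) ¬ab (¬Adj-y xa) (¬Adj-y xb))

    chromatic : ChromaticNumberOn G Gₓ (length (members component?))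
    chromatic = complete-chromatic component? complete (here x∉S)

  module TwoComponents (noTriple : NoStableTriple) (S : Subset n)
                       {u₁ u₂ : Fin n} (u₁∉S : u₁ ∉ S) (u₂∉S : u₂ ∉ S)
                       (u₁↛u₂ : ¬ Reach G (Outside G S) u₁ u₂) where

    module G₁ = Separated noTriple S u₁∉S u₂∉S u₁↛u₂
    module G₂ = Separated noTriple S u₂∉S u₁∉S (u₁↛u₂ ∘ reach-sym)

    -- G₁ and G₂ are disjoint with no edges between them: a common vertex
    -- would be u₂ or a neighbour of u₂, hence joined to u₂ inside G ∖ S.
    disjoint : ∀ {v} → G₁.Gₓ v → G₂.Gₓ v → ⊥
    disjoint u₁v u₂v with G₂.dominated u₂v
    ... | inj₁ refl = u₁↛u₂ u₁v
    ... | inj₂ u₂v′ = G₁.¬Adj-y u₁v (Adj-sym u₂v′)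

    no-edges : ∀ a b → G₁.Gₓ a → G₂.Gₓ b → ¬ Adj G a b
    no-edges a b u₁a u₂b ab = disjoint (step u₁a ab (reach-end u₂b)) u₂b

    -- (i) A vertex of G ∖ S outside G₁ and G₂ would be stable with u₁, u₂.
    covers : ∀ v → v ∉ S → G₁.Gₓ v ⊎ G₂.Gₓ v
    covers v v∉S with G₁.component? v | G₂.component? v
    ... | yes u₁v | _       = inj₁ u₁v
    ... | no _    | yes u₂v = inj₂ u₂v
    ... | no u₁↛v | no u₂↛v = ⊥-elim (noTriple u₁ u₂ v (G₁.≢y (here u₁∉S))
          (λ { refl → u₁↛v (here u₁∉S) }) (λ { refl → u₂↛v (here u₂∉S) })
          (G₁.¬Adj-y (here u₁∉S))
          (λ u₁v → u₁↛v (step (here u₁∉S) u₁v v∉S)) (λ u₂v → u₂↛v (step (here u₂∉S) u₂v v∉S)))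

    -- (iii) Gluing optimal colourings of G₁, G₂ gives a colouring of G with
    -- 1 + max(χ(G₁), χ(G₂)) colours.
    chromatic-bound : ∀ {k} → ChromaticNumber G k → Stable G S →
      k ∸ 1 ≤ length (members G₁.component?) ⊔ length (members G₂.component?)
    chromatic-bound (_ , minimal) stS = ∸-monoˡ-≤ 1 (minimal _ (glue-colourings stS covers no-edges
      (proj₁ G₁.chromatic) (proj₁ G₂.chromatic)))

    -- (iv) If u ∈ S misses a ∈ G₁ and b ∈ G₂, then u, a, b are stable.
    attached : ∀ u → u ∈ S → (∀ v → G₁.Gₓ v → Adj G u v) ⊎ (∀ v → G₂.Gₓ v → Adj G u v)
    attached u u∈S with any? (λ v → G₁.component? v ×-dec ¬? (adj? u v))
    ... | no ∄a = inj₁ adjacent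
      where
      adjacent : ∀ v → G₁.Gₓ v → Adj G u v
      adjacent v u₁v with adj? u v
      ... | yes uv = uv
      ... | no ¬uv = ⊥-elim (∄a (v , u₁v , ¬uv))
    ... | yes (a , u₁a , ¬ua) = inj₂ adjacent
      where
      adjacent : ∀ b → G₂.Gₓ b → Adj G u b
      adjacent b u₂b with adj? u b
      ... | yes ub = ub
      ... | no ¬ub = ⊥-elim (noTriple u a b
            (λ { refl → reach-end u₁a u∈S }) (λ { refl → reach-end u₂b u∈S })
            (λ { refl → disjoint u₁a u₂b }) ¬ua ¬ub (no-edges a b u₁a u₂b))

proposition2p2 : {n : ℕ} (G : Graph n) (k : ℕ) (S : Subset n) →
    Connected G → ChromaticNumber G k → IndependenceNumber G 2 →
    CutSet G S → ∣ S ∣ ≤ 2 → Stable G S →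
    Σ (Fin n) λ u₁ → Σ (Fin n) λ u₂ →
      (u₁ ∉ S) × (u₂ ∉ S) × ¬ Reach G (Outside G S) u₁ u₂ ×
      (∀ v → v ∉ S → ComponentOf G S u₁ v ⊎ ComponentOf G S u₂ v) ×
      Complete G (ComponentOf G S u₁) × Complete G (ComponentOf G S u₂) ×
      (Σ ℕ λ k₁ → Σ ℕ λ k₂ →
        ChromaticNumberOn G (ComponentOf G S u₁) k₁ ×
        ChromaticNumberOn G (ComponentOf G S u₂) k₂ ×
        k ∸ 1 ≤ k₁ ⊔ k₂) ×
      (∀ u → u ∈ S →
        (∀ v → ComponentOf G S u₁ v → Adj G u v) ⊎
        (∀ v → ComponentOf G S u₂ v → Adj G u v))
proposition2p2 G k S _ χ (_ , α≤2) (u₁ , u₂ , u₁∉S , u₂∉S , u₁↛u₂) _ stS =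
  u₁ , u₂ , u₁∉S , u₂∉S , u₁↛u₂ ,
  covers ,
  G₁.complete , G₂.complete ,
  (_ , _ , G₁.chromatic , G₂.chromatic , chromatic-bound χ stS) ,
  attached
  where
  open TwoComponents G (α≤2⇒no-stable-triple G α≤2) S u₁∉S u₂∉S u₁↛u₂
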